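{- Let $G_i$ be a finite simple undirected graph with an orientation $\overline{G}_i$ in which there is no improving path between any two vertices. Perform one update of the algorithm StrongDynOpt on an edge $\{u,v\}$ (insertion of an edge not in $G_i$ or deletion of an edge of $G_i$), and suppose the call of FindAndFlipPath$(u)$ (insertion) resp. FindAndFlipPathRev$(u)$ (deletion) finds an improving path $P$. Let $\overline{G}_{i+1}$ be the resulting orientation and $P_f$ the path obtained by flipping every edge of $P$ (a directed path in $\overline{G}_{i+1}$). Then every improving path in $\overline{G}_{i+1}$ shares at least one vertex with $P_f$.
   Context: An orientation of an undirected graph $G=(V,E)$ is a directed graph $\vec{G}=(V,E')$ such that for every $\{x,y\}\in E$ exactly one of $(x,y),(y,x)$ lies in $E'$; $\mathrm{odeg}(x,\vec{G})$ is the number of edges of $E'$ starting at $x$. A directed path $\langle v_0,\dots,v_k\rangle$ in $\vec{G}$ is an improving path if $\mathrm{odeg}(v_0,\vec{G})>\mathrm{odeg}(v_k,\vec{G})+1$. Flipping an edge $(x,y)$ means replacing it by $(y,x)$; out-degrees below always refer to the current orientation at the moment they are evaluated. FindAndFlipPath$(x)$ (a depth-first search, with a visited array that is all false at the start of each top-level call): if $x$ is visited, return false; for each out-neighbour $y$ of $x$, if $\mathrm{odeg}(y)<\mathrm{odeg}(x)-1$, flip $(x,y)$ and return true; mark $x$ visited; for each out-neighbour $y$ of $x$ with $\mathrm{odeg}(y)=\mathrm{odeg}(x)-1$, if FindAndFlipPath$(y)$ returns true, flip $(x,y)$ and return true; return false. FindAndFlipPathRev$(x)$ (same visited convention): if $x$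 is visited, return false; for each $y$ with $(y,x)$ an edge, if $\mathrm{odeg}(y)>\mathrm{odeg}(x)+1$, flip $(y,x)$ and return true; mark $x$ visited; for each $y$ with $(y,x)$ an edge and $\mathrm{odeg}(y)=\mathrm{odeg}(x)+1$, if FindAndFlipPathRev$(y)$ returns true, flip $(y,x)$ and return true; return false. When a call returns true, the edges it flipped form (before flipping) a directed path of the orientation on which it was called; this is the path the call is said to find. StrongDynOpt update procedures: Insert$\{u,v\}$: label the endpoints so that $\mathrm{odeg}(u)\le\mathrm{odeg}(v)$ in the current orientation, add the directed edge $(u,v)$, and call FindAndFlipPath$(u)$. Delete$\{u,v\}$: label the endpoints so that the edge is currently oriented as $(u,v)$, remove it, and call FindAndFlipPathRev$(u)$. -}

module Defs where

open import Data.Nat using (ℕ; zero; suc; _+_; _<_; _<?_)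
open import Data.Nat.Properties using () renaming (_≟_ to _≟ℕ_)
open import Data.Fin using (Fin; _≟_)
open import Data.Product using (_×_; _,_; proj₁; proj₂; swap)
open import Data.Sum using (_⊎_)
open import Data.Bool using (Bool; true; false; if_then_else_; _∧_)
import Data.Bool as B
open import Data.Maybe using (Maybe; just; nothing)
open import Data.Unit using (⊤)
open import Data.List using (List; []; _∷_; length; filter; map; reverse)
open import Data.List.Membership.Propositional using (_∈_)
import Data.List.Membership.DecPropositional
open import Data.List.Relation.Unary.All using (All)
open import Data.List.Relation.Unary.AllPairs using (AllPairs)
open import Data.List.Relation.Unary.Unique.Propositional using (Unique)
open import Relation.Binary.PropositionalEquality using (_≡_; _≢_)
open import Relation.Nullary using (¬_; does)

-- Vertices are Fin n.  An orientation is a list of directed edges (x , y);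
-- the list order only fixes the (arbitrary) order in which neighbours are scanned.
Edge : ℕ → Set
Edge n = Fin n × Fin n

Orientation : ℕ → Set
Orientation n = List (Edge n)

SameEdge : ∀ {n} → Edge n → Edge n → Set
SameEdge e f = (e ≡ f) ⊎ (e ≡ swap f)

ValidOrientation : ∀ {n} → Orientation n → Set
ValidOrientation D = All (λ e → proj₁ e ≢ proj₂ e) D × AllPairs (λ e f → ¬ SameEdge e f) D

odeg : ∀ {n} → Orientation n → Fin n → ℕ
odeg D x = length (filter (λ e → proj₁ e ≟ x) D)

outN : ∀ {n} → Orientation n → Fin n → List (Fin n)
outN D x = map proj₂ (filter (λ e → proj₁ e ≟ x) D)

inN : ∀ {n} → Orientation n → Fin n → List (Fin n)
inN D x = map proj₁ (filter (λ e → proj₂ e ≟ x) D)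

Chain : ∀ {n} → Orientation n → Fin n → List (Fin n) → Set
Chain D x [] = ⊤
Chain D x (y ∷ ys) = ((x , y) ∈ D) × Chain D y ys

lastV : ∀ {n} → Fin n → List (Fin n) → Fin n
lastV x [] = x
lastV x (y ∷ ys) = lastV y ys

Improving : ∀ {n} → Orientation n → Fin n → List (Fin n) → Set
Improving D v₀ vs =
  Chain D v₀ vs × Unique (v₀ ∷ vs) × (odeg D (lastV v₀ vs) + 1 < odeg D v₀)

-- Generic depth-first search as in FindAndFlipPath(Rev).  The orientation is not
-- modified during the search (flips only happen while returning true), so we
-- return the list of vertices visited along the successful branch (starting at x)
-- and perform the flips afterwards.  Fuel suc n is enough: every nested call that
-- does not immediately return marks a new vertex as visited.
module DFS {n : ℕ} (nbrs : Fin n → List (Fin n))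
           (jump step : Fin n → Fin n → Bool) where
  module M = Data.List.Membership.DecPropositional (_≟_ {n})

  Result : Set
  Result = Maybe (List (Fin n)) × List (Fin n)

  mutual
    dfs : ℕ → List (Fin n) → Fin n → Result
    dfs zero vis x = nothing , vis
    dfs (suc f) vis x =
      if does (x M.∈? vis) then (nothing , vis) else first f vis x (nbrs x)

    first : ℕ → List (Fin n) → Fin n → List (Fin n) → Result
    first f vis x [] = loop f (x ∷ vis) x (filter (λ y → step x y B.≟ true) (nbrs x))
    first f vis x (y ∷ ys) = if jump x y then (just (x ∷ y ∷ []) , vis) else first f vis x ys

    loop : ℕ → List (Fin n) → Fin n → List (Fin n) → Result
    loop f vis x [] = nothing , vis
    loop f vis x (y ∷ ys) = cont (dfs f vis y)
      where
      cont : Result → Result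
      cont (just p , vis') = just (x ∷ p) , vis'
      cont (nothing , vis') = loop f vis' x ys

-- FindAndFlipPath(x) on D: returns the vertex sequence x = v₀, v₁, …, vₖ of the
-- found directed path (edges (vᵢ , vᵢ₊₁)), or nothing if it returns false.
findPath : ∀ {n} → Orientation n → Fin n → Maybe (List (Fin n))
findPath {n} D x = proj₁ (DFS.dfs (outN D)
  (λ x y → does (odeg D y + 1 <? odeg D x))
  (λ x y → does (odeg D y + 1 ≟ℕ odeg D x)) (suc n) [] x)

-- FindAndFlipPathRev(x) on D: returns x = w₀, w₁, …, wₖ where the found directed
-- path is wₖ → … → w₁ → w₀ (edges (wᵢ₊₁ , wᵢ)).
findPathRev : ∀ {n} → Orientation n → Fin n → Maybe (List (Fin n))
findPathRev {n} D x = proj₁ (DFS.dfs (inN D)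
  (λ x y → does (odeg D x + 1 <? odeg D y))
  (λ x y → does (odeg D y ≟ℕ odeg D x + 1)) (suc n) [] x)

flipEdge : ∀ {n} → Fin n → Fin n → Orientation n → Orientation n
flipEdge x y = map (λ e → if does (proj₁ e ≟ x) ∧ does (proj₂ e ≟ y) then (y , x) else e)

flipPath : ∀ {n} → Orientation n → List (Fin n) → Orientation n
flipPath D [] = D
flipPath D (x ∷ []) = D
flipPath D (x ∷ y ∷ ys) = flipPath (flipEdge x y D) (y ∷ ys)

-- Inserting or deleting the edge {u,v} changes out-edges and out-degrees only
-- at u, and flipping a path changes them only at vertices of the path; since
-- u lies on the flipped path P_f, every vertex off P_f has the same out-degree
-- and (a subset of) the same out-edges as in Ḡᵢ.  An improving path of Ḡᵢ₊₁
-- avoiding P_f would thus already be an improving path of Ḡᵢ, which has none.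
module Submission where

open import Defs
open import Data.Nat using (ℕ; zero; suc; _≤_; _+_; _<_)
open import Data.Fin using (Fin; _≟_)
open import Data.Product using (_×_; _,_; ∃; proj₁; proj₂)
open import Data.Sum using (_⊎_; inj₁; inj₂)
open import Data.Bool using (Bool; true; false; if_then_else_; _∧_) renaming (_≟_ to _≟ᵇ_)
open import Data.Maybe using (just; nothing)
import Data.Maybe.Relation.Unary.All as Maybe
open import Data.Unit using (tt)
open import Data.Empty using (⊥-elim)
open import Data.List using (List; []; _∷_; [_]; _++_; reverse; filter; map; length)
open import Data.List.Properties using (filter-++; filter-reject)
open import Data.List.Membership.Propositional using (_∈_; _∉_; find)
open import Data.List.Membership.Propositional.Properties
  using (∈-++⁺ˡ; ∈-++⁺ʳ; ∈-++⁻; ∈-map⁻)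
import Data.List.Membership.DecPropositional as DecMembership
open import Data.List.Relation.Binary.Subset.Propositional using (_⊆_)
open import Data.List.Relation.Binary.Subset.Propositional.Properties
  using (xs⊆x∷xs; xs⊆xs++ys)
open import Data.List.Relation.Unary.Any using (here; there; any?)
open import Data.List.Relation.Unary.Any.Properties using (reverse⁺; reverse⁻)
open import Data.List.Relation.Unary.All using (All; _∷_) renaming (lookup to All-lookup)
open import Data.List.Relation.Unary.All.Properties using (¬Any⇒All¬)
open import Relation.Binary.PropositionalEquality
  using (_≡_; _≢_; refl; sym; trans; cong; subst; subst₂; module ≡-Reasoning)
open import Relation.Nullary using (¬_; Dec; does; yes; no)
open import Relation.Nullary.Decidable using (dec-false)
open import Relation.Unary using (Pred; Decidable)
open import Level using (0ℓ)

module _ {n : ℕ} where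

  record SameOutside (S : List (Fin n)) (D′ D : Orientation n) : Set where
    field
      out-⊆  : ∀ {x y} → x ∉ S → (x , y) ∈ D′ → (x , y) ∈ D
      odeg-≡ : ∀ {x} → x ∉ S → odeg D′ x ≡ odeg D x

  open SameOutside

  sameOutside-refl : ∀ {S D} → SameOutside S D D
  sameOutside-refl = record { out-⊆ = λ _ e → e ; odeg-≡ = λ _ → refl }

  sameOutside-trans : ∀ {S D₁ D₂ D₃} →
    SameOutside S D₁ D₂ → SameOutside S D₂ D₃ → SameOutside S D₁ D₃
  sameOutside-trans s t = record
    { out-⊆  = λ x∉S e → out-⊆ t x∉S (out-⊆ s x∉S e)
    ; odeg-≡ = λ x∉S → trans (odeg-≡ s x∉S) (odeg-≡ t x∉S)
    }

  sameOutside-mono : ∀ {S T D′ D} → S ⊆ T → SameOutside S D′ D → SameOutside T D′ D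
  sameOutside-mono S⊆T s = record
    { out-⊆  = λ x∉T → out-⊆ s (λ x∈S → x∉T (S⊆T x∈S))
    ; odeg-≡ = λ x∉T → odeg-≡ s (λ x∈S → x∉T (S⊆T x∈S))
    }

  lastV-∈ : ∀ (w : Fin n) ws → lastV w ws ∈ w ∷ ws
  lastV-∈ w []       = here refl
  lastV-∈ w (y ∷ ys) = there (lastV-∈ y ys)

  chain-transfer : ∀ {S D′ D} → SameOutside S D′ D →
    ∀ w ws → All (_∉ S) (w ∷ ws) → Chain D′ w ws → Chain D w ws
  chain-transfer s w []       _           _        = tt
  chain-transfer s w (y ∷ ys) (w∉S ∷ ∉S) (e , c) =
    out-⊆ s w∉S e , chain-transfer s y ys ∉S c

  improving-transfer : ∀ {S D′ D} → SameOutside S D′ D →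
    ∀ {w ws} → All (_∉ S) (w ∷ ws) → Improving D′ w ws → Improving D w ws
  improving-transfer s {w} {ws} ∉S (c , unique , gap) =
    chain-transfer s w ws ∉S c , unique ,
    subst₂ (λ a b → a + 1 < b)
      (odeg-≡ s (All-lookup ∉S (lastV-∈ w ws))) (odeg-≡ s (All-lookup ∉S (here refl))) gap

  improving-meets : ∀ {S D′ D} → SameOutside S D′ D →
    (∀ w ws → ¬ Improving D w ws) →
    ∀ {w ws} → Improving D′ w ws → ∃ λ z → z ∈ w ∷ ws × z ∈ S
  improving-meets {S} s noImp {w} {ws} imp with any? (_∈? S) (w ∷ ws)
    where open DecMembership (_≟_ {n}) using (_∈?_)
  ... | yes meets = find meets
  ... | no avoids = ⊥-elim (noImp w ws (improving-transfer s (¬Any⇒All¬ _ avoids) imp))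

  length-filter-map : ∀ {P : Pred (Edge n) 0ℓ} (P? : Decidable P) (f : Edge n → Edge n) →
    (∀ e → does (P? (f e)) ≡ does (P? e)) →
    ∀ E → length (filter P? (map f E)) ≡ length (filter P? E)
  length-filter-map P? f same []       = refl
  length-filter-map P? f same (e ∷ E) with does (P? (f e)) | does (P? e) | same e
  ... | true  | .true  | refl = cong suc (length-filter-map P? f same E)
  ... | false | .false | refl = length-filter-map P? f same E

  flipMatching : Fin n → Fin n → Edge n → Edge n
  flipMatching a b e = if does (proj₁ e ≟ a) ∧ does (proj₂ e ≟ b) then (b , a) else e

  flipMatching-cases : ∀ a b e →
    (flipMatching a b e ≡ e) ⊎ (proj₁ e ≡ a × flipMatching a b e ≡ (b , a))
  flipMatching-cases a b (x , y) with x ≟ a | y ≟ b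
  ... | yes x≡a | yes _ = inj₂ (x≡a , refl)
  ... | yes _   | no _  = inj₁ refl
  ... | no _    | _     = inj₁ refl

  flipEdge-sameOutside : ∀ a b E → SameOutside (a ∷ b ∷ []) (flipEdge a b E) E
  flipEdge-sameOutside a b E = record { out-⊆ = out ; odeg-≡ = deg }
    where
    out : ∀ {x y} → x ∉ a ∷ b ∷ [] → (x , y) ∈ flipEdge a b E → (x , y) ∈ E
    out x∉ e∈ with ∈-map⁻ (flipMatching a b) e∈
    ... | e , e∈E , xy≡ with flipMatching-cases a b e
    ...   | inj₁ kept         = subst (_∈ E) (sym (trans xy≡ kept)) e∈E
    ...   | inj₂ (_ , turned) =
      ⊥-elim (x∉ (there (here (cong proj₁ (trans xy≡ turned)))))

    deg : ∀ {x} → x ∉ a ∷ b ∷ [] → odeg (flipEdge a b E) x ≡ odeg E x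
    deg {x} x∉ = length-filter-map (λ e → proj₁ e ≟ x) (flipMatching a b) sameSource E
      where
      sameSource : ∀ e → does (proj₁ (flipMatching a b e) ≟ x) ≡ does (proj₁ e ≟ x)
      sameSource e with flipMatching a b e | flipMatching-cases a b e
      ... | _ | inj₁ refl        = refl
      ... | _ | inj₂ (e₁≡a , refl) =
        trans (dec-false (b ≟ x) (λ b≡x → x∉ (there (here (sym b≡x)))))
              (sym (dec-false (proj₁ e ≟ x)
                     (λ e₁≡x → x∉ (here (trans (sym e₁≡x) e₁≡a)))))

  flipPath-sameOutside : ∀ E P → SameOutside P (flipPath E P) E
  flipPath-sameOutside E []           = sameOutside-refl
  flipPath-sameOutside E (a ∷ [])     = sameOutside-refl
  flipPath-sameOutside E (a ∷ b ∷ ys) = sameOutside-trans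
    (sameOutside-mono (xs⊆x∷xs (b ∷ ys) a) (flipPath-sameOutside (flipEdge a b E) (b ∷ ys)))
    (sameOutside-mono (xs⊆xs++ys (a ∷ b ∷ []) ys) (flipEdge-sameOutside a b E))

  odeg-insert : ∀ L R {u v x} → x ≢ u → odeg (L ++ (u , v) ∷ R) x ≡ odeg (L ++ R) x
  odeg-insert L R {u} {v} {x} x≢u = begin
    length (from (L ++ (u , v) ∷ R))         ≡⟨ cong length (filter-++ source≟ L _) ⟩
    length (from L ++ from ((u , v) ∷ R))    ≡⟨ cong (λ es → length (from L ++ es))
                                                  (filter-reject source≟ (λ u≡x → x≢u (sym u≡x))) ⟩
    length (from L ++ from R)                ≡⟨ cong length (sym (filter-++ source≟ L R)) ⟩
    length (from (L ++ R))                   ∎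
    where
    open ≡-Reasoning
    source≟ : (e : Edge n) → Dec (proj₁ e ≡ x)
    source≟ e = proj₁ e ≟ x
    from : Orientation n → Orientation n
    from = filter source≟

  insert-sameOutside : ∀ L R u v → SameOutside [ u ] (L ++ (u , v) ∷ R) (L ++ R)
  insert-sameOutside L R u v = record
    { out-⊆  = out
    ; odeg-≡ = λ x∉ → odeg-insert L R (λ x≡u → x∉ (here x≡u))
    }
    where
    out : ∀ {x y} → x ∉ [ u ] → (x , y) ∈ L ++ (u , v) ∷ R → (x , y) ∈ L ++ R
    out x∉ e∈ with ∈-++⁻ L e∈
    ... | inj₁ e∈L          = ∈-++⁺ˡ e∈L
    ... | inj₂ (here xy≡uv) = ⊥-elim (x∉ (here (cong proj₁ xy≡uv)))
    ... | inj₂ (there e∈R)  = ∈-++⁺ʳ L e∈R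

  delete-sameOutside : ∀ L R u v → SameOutside [ u ] (L ++ R) (L ++ (u , v) ∷ R)
  delete-sameOutside L R u v = record
    { out-⊆  = out
    ; odeg-≡ = λ x∉ → sym (odeg-insert L R (λ x≡u → x∉ (here x≡u)))
    }
    where
    out : ∀ {x y} → x ∉ [ u ] → (x , y) ∈ L ++ R → (x , y) ∈ L ++ (u , v) ∷ R
    out _ e∈ with ∈-++⁻ L e∈
    ... | inj₁ e∈L = ∈-++⁺ˡ e∈L
    ... | inj₂ e∈R = ∈-++⁺ʳ L (there e∈R)

  module _ (nbrs : Fin n → List (Fin n)) (jump step : Fin n → Fin n → Bool) where
    open DFS nbrs jump step

    mutual
      dfs-∋-root : ∀ f vis x → Maybe.All (x ∈_) (proj₁ (dfs f vis x))
      dfs-∋-root zero    vis x = Maybe.nothing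
      dfs-∋-root (suc f) vis x with does (x M.∈? vis)
      ... | true  = Maybe.nothing
      ... | false = first-∋-root f vis x (nbrs x)

      first-∋-root : ∀ f vis x ys → Maybe.All (x ∈_) (proj₁ (first f vis x ys))
      first-∋-root f vis x []       =
        loop-∋-root f (x ∷ vis) x (filter (λ y → step x y ≟ᵇ true) (nbrs x))
      first-∋-root f vis x (y ∷ ys) with jump x y
      ... | true  = Maybe.just (here refl)
      ... | false = first-∋-root f vis x ys

      loop-∋-root : ∀ f vis x ys → Maybe.All (x ∈_) (proj₁ (loop f vis x ys))
      loop-∋-root f vis x []       = Maybe.nothing
      loop-∋-root f vis x (y ∷ ys) with dfs f vis y
      ... | just _  , _    = Maybe.just (here refl)
      ... | nothing , vis′ = loop-∋-root f vis′ x ys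

    search-∋-root : ∀ {f x P} → proj₁ (dfs f [] x) ≡ just P → x ∈ P
    search-∋-root {f} {x} found with subst (Maybe.All (x ∈_)) found (dfs-∋-root f [] x)
    ... | Maybe.just x∈P = x∈P

findPath-∋ : ∀ {n} (D : Orientation n) {x P} → findPath D x ≡ just P → x ∈ P
findPath-∋ {n} D found = search-∋-root (outN D) _ _ {suc n} found

findPathRev-∋ : ∀ {n} (D : Orientation n) {x Q} → findPathRev D x ≡ just Q → x ∈ Q
findPathRev-∋ {n} D found = search-∋-root (inN D) _ _ {suc n} found

insertAndFlip-sameOutside : ∀ {n} L R (u v : Fin n) {P} →
  findPath (L ++ (u , v) ∷ R) u ≡ just P →
  SameOutside P (flipPath (L ++ (u , v) ∷ R) P) (L ++ R)
insertAndFlip-sameOutside L R u v {P} found = sameOutside-trans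
  (flipPath-sameOutside (L ++ (u , v) ∷ R) P)
  (sameOutside-mono (λ { (here refl) → findPath-∋ (L ++ (u , v) ∷ R) found })
    (insert-sameOutside L R u v))

deleteAndFlip-sameOutside : ∀ {n} L R (u v : Fin n) {Q} →
  findPathRev (L ++ R) u ≡ just Q →
  SameOutside Q (flipPath (L ++ R) (reverse Q)) (L ++ (u , v) ∷ R)
deleteAndFlip-sameOutside L R u v {Q} found = sameOutside-trans
  (sameOutside-mono reverse⁻ (flipPath-sameOutside (L ++ R) (reverse Q)))
  (sameOutside-mono (λ { (here refl) → findPathRev-∋ (L ++ R) found })
    (delete-sameOutside L R u v))

-- Besides the absence of improving paths in D, none of the hypotheses
-- (validity of D, the side conditions of Insert) is needed.
lemma3p4 : (n : ℕ) (D : Orientation n) → ValidOrientation D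
    → (∀ (w : Fin n) (ws : List (Fin n)) → ¬ Improving D w ws)
    → ((u v : Fin n) (L R : Orientation n) (P : List (Fin n))
        → D ≡ L ++ R → u ≢ v → ¬ ((u , v) ∈ D) → ¬ ((v , u) ∈ D)
        → odeg D u ≤ odeg D v
        → findPath (L ++ (u , v) ∷ R) u ≡ just P
        → (w : Fin n) (ws : List (Fin n))
        → Improving (flipPath (L ++ (u , v) ∷ R) P) w ws
        → ∃ λ z → z ∈ w ∷ ws × z ∈ reverse P)
    × ((u v : Fin n) (L R : Orientation n) (Q : List (Fin n))
        → D ≡ L ++ (u , v) ∷ R
        → findPathRev (L ++ R) u ≡ just Q
        → (w : Fin n) (ws : List (Fin n))
        → Improving (flipPath (L ++ R) (reverse Q)) w ws
        → ∃ λ z → z ∈ w ∷ ws × z ∈ Q)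
lemma3p4 n D _ noImprovingPath =
  (λ { u v L R P refl _ _ _ _ found _ _ improving →
         improving-meets (sameOutside-mono reverse⁺ (insertAndFlip-sameOutside L R u v found))
           noImprovingPath improving })
  , (λ { u v L R Q refl found _ _ improving →
         improving-meets (deleteAndFlip-sameOutside L R u v found) noImprovingPath improving })
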